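{- Let $m\mid n$ and let $(V,\mathcal{G},\mathcal{B})$ be a group divisible triangle design of order $n$ with groups of dimension $m$ over $\mathbb{F}_2$, where $V=\mathbb{F}_{2^n}$, $\mathcal{G}=\{a\mathbb{F}_{2^m}: a\in\mathbb{F}_{2^n}^*\}$ is the Desarguesian spread, and $\mathcal{B}$ is invariant under the action of $G=\mathbb{F}_{2^n}^*$ by multiplication. If $\{B_1,B_2,B_3\}\in\mathcal{B}$, then the $G$-orbits of $B_1,B_2,B_3$ are pairwise distinct and each has cardinality $2^n-1$.
   Context: A triangle is a set $\{\langle a,b\rangle,\langle b,c\rangle,\langle c,a\rangle\}$ of $2$-dimensional $\mathbb{F}_2$-subspaces with $a,b,c$ linearly independent. A group divisible triangle design of order $n$ with groups of dimension $m$ over $\mathbb{F}_q$ is a triple $(V,\mathcal{G},\mathcal{B})$: $V$ an $n$-dimensional $\mathbb{F}_q$-space, $\mathcal{G}$ a set of $m$-dimensional subspaces such that every nonzero vector lies in exactly one, and $\mathcal{B}$ a set of triangles such that every $2$-dimensional subspace either belongs to exactly one triangle of $\mathcal{B}$ and to no group, or to no triangle and to one group. The $G$-orbit of a subspace $U$ is $\{\gamma U:\gamma\in\mathbb{F}_{2^n}^*\}$. -}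

module Defs where

open import Data.Nat using (ℕ; zero; suc; _^_)
open import Data.Bool using (Bool; true; false; _∨_)
open import Data.Fin using (Fin)
import Data.Fin as Fin
open import Data.Fin.Subset using (Subset; _∈_; _⊆_)
open import Data.Vec using (tabulate; lookup)
open import Data.Product using (Σ; ∃; _×_; _,_)
open import Data.Sum using (_⊎_)
open import Relation.Nullary using (¬_; Dec; yes; no)
open import Relation.Nullary.Decidable using (⌊_⌋; map′)
open import Relation.Binary.PropositionalEquality using (_≡_; _≢_; refl; sym; trans; cong)
open import Function.Bundles using (_↔_; Inverse)
open import Algebra.Structures using (IsCommutativeRing)

-- A finite field of order 2 ^ n (unique up to isomorphism: this is F_{2^n}).
-- Equality is propositional; the carrier is enumerated by Fin (2 ^ n).
record GF2^ (n : ℕ) : Set₁ where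
  infixl 6 _+_
  infixl 7 _*_
  field
    F           : Set
    0# 1#       : F
    _+_ _*_     : F → F → F
    -_          : F → F
    _⁻¹         : F → F
    isCommRing  : IsCommutativeRing _≡_ _+_ _*_ -_ 0# 1#
    0≢1         : 0# ≢ 1#
    inverse     : ∀ x → x ≢ 0# → x * (x ⁻¹) ≡ 1#
    enum        : F ↔ Fin (2 ^ n)

module _ {n : ℕ} (K : GF2^ n) where
  open GF2^ K
  open Inverse enum using (to; from; strictlyInverseʳ)

  _≟F_ : (x y : F) → Dec (x ≡ y)
  x ≟F y = map′ (λ p → trans (sym (strictlyInverseʳ x)) (trans (cong from p) (strictlyInverseʳ y)))
                (cong to) (to x Fin.≟ to y)

  -- subsets of V = F_{2^n}, encoded as Bool-vectors over the enumeration
  -- (so equality of sets is propositional equality)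
  Sub : Set
  Sub = Subset (2 ^ n)

  _∈V_ : F → Sub → Set
  x ∈V U = to x ∈ U

  fromPred : (F → Bool) → Sub
  fromPred p = tabulate (λ i → p (from i))

  sel : Bool → F → F
  sel true  x = x
  sel false x = 0#

  Indep2 : F → F → Set
  Indep2 a b = ∀ (e₁ e₂ : Bool) → (e₁ ∨ e₂) ≡ true → sel e₁ a + sel e₂ b ≢ 0#

  Indep3 : F → F → F → Set
  Indep3 a b c = ∀ (e₁ e₂ e₃ : Bool) → (e₁ ∨ e₂ ∨ e₃) ≡ true →
                 sel e₁ a + sel e₂ b + sel e₃ c ≢ 0#

  span2 : F → F → Sub
  span2 a b = fromPred (λ x →
       ⌊ x ≟F (sel false a + sel false b) ⌋ ∨ ⌊ x ≟F (sel true a + sel false b) ⌋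
     ∨ ⌊ x ≟F (sel false a + sel true b) ⌋ ∨ ⌊ x ≟F (sel true a + sel true b) ⌋)

  IsSub2 : Sub → Set
  IsSub2 U = ∃ λ a → ∃ λ b → Indep2 a b × U ≡ span2 a b

  -- γU = { γ u : u ∈ U }  (used for γ ≠ 0)
  _·_ : F → Sub → Sub
  γ · U = fromPred (λ x → lookup U (to (γ ⁻¹ * x)))

  pow : F → ℕ → F
  pow x zero    = 1#
  pow x (suc k) = x * pow x k

  subfield : ℕ → Sub
  subfield m = fromPred (λ y → ⌊ pow y (2 ^ m) ≟F y ⌋)

  grp : ℕ → F → Sub
  grp m a = a · subfield m

  InSomeGroup : ℕ → Sub → Set
  InSomeGroup m U = ∃ λ a → a ≢ 0# × U ⊆ grp m a

  InExactlyOneGroup : ℕ → Sub → Set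
  InExactlyOneGroup m U = ∃ λ a → a ≢ 0# × U ⊆ grp m a ×
    (∀ a' → a' ≢ 0# → U ⊆ grp m a' → grp m a' ≡ grp m a)

  IsTriangle : Sub → Sub → Sub → Set
  IsTriangle X Y Z = ∃ λ a → ∃ λ b → ∃ λ c →
    Indep3 a b c × X ≡ span2 a b × Y ≡ span2 b c × Z ≡ span2 c a

  InTri : Sub → Sub → Sub → Sub → Set
  InTri U X Y Z = U ≡ X ⊎ U ≡ Y ⊎ U ≡ Z

  SameTri : Sub → Sub → Sub → Sub → Sub → Sub → Set
  SameTri X Y Z X' Y' Z' =
    ∀ W → (InTri W X Y Z → InTri W X' Y' Z') × (InTri W X' Y' Z' → InTri W X Y Z)

  -- A set of triangles is represented by a predicate 𝓑 X Y Z meaning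
  -- {X,Y,Z} ∈ 𝓑; it must respect equality of the sets {X,Y,Z}.
  BlockSet : Set₁
  BlockSet = Sub → Sub → Sub → Set

  InExactlyOneTri : BlockSet → Sub → Set
  InExactlyOneTri 𝓑 U = ∃ λ X → ∃ λ Y → ∃ λ Z → 𝓑 X Y Z × InTri U X Y Z ×
    (∀ X' Y' Z' → 𝓑 X' Y' Z' → InTri U X' Y' Z' → SameTri X Y Z X' Y' Z')

  InNoTri : BlockSet → Sub → Set
  InNoTri 𝓑 U = ∀ X Y Z → 𝓑 X Y Z → ¬ InTri U X Y Z

  record IsDesarguesianGDTD (m : ℕ) (𝓑 : BlockSet) : Set where
    field
      respectsSets : ∀ X Y Z X' Y' Z' → SameTri X Y Z X' Y' Z' → 𝓑 X Y Z → 𝓑 X' Y' Z'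
      triangles    : ∀ X Y Z → 𝓑 X Y Z → IsTriangle X Y Z
      partition    : ∀ U → IsSub2 U →
                       (InExactlyOneTri 𝓑 U × ¬ InSomeGroup m U)
                     ⊎ (InNoTri 𝓑 U × InExactlyOneGroup m U)

  GInvariant : BlockSet → Set
  GInvariant 𝓑 = ∀ γ X Y Z → γ ≢ 0# → 𝓑 X Y Z → 𝓑 (γ · X) (γ · Y) (γ · Z)

  InOrbit : Sub → Sub → Set
  InOrbit U W = ∃ λ γ → γ ≢ 0# × W ≡ γ · U

  -- elements of the orbit of U (the membership proof is irrelevant, so two
  -- elements are equal iff their subspaces are equal)
  record Orbit (U : Sub) : Set where
    constructor orb
    field
      elt    : Sub
      .inOrb : InOrbit U elt

  SameOrbit : Sub → Sub → Set
  SameOrbit U U' = ∀ W → (InOrbit U W → InOrbit U' W) × (InOrbit U' W → InOrbit U W)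

{-# OPTIONS --safe #-}
-- Let the block be the triangle with sides ⟨a,b⟩, ⟨b,c⟩, ⟨c,a⟩. If γ ∈ F* maps one side onto
-- a side of the same block, then the blocks B and γB share a side; as a 2-space lies in at
-- most one block, γ permutes the three sides. Each vertex is the nonzero vector common to two
-- sides, so γ permutes a, b, c and fixes a + b + c ≠ 0, whence γ = 1. Hence F* acts freely on
-- the orbit of each side, which thus has 2 ^ n - 1 elements, and distinct sides lie in
-- distinct orbits. Characteristic 2, needed for F₂-coordinates, holds because otherwise
-- x ↦ - x would be a fixed-point-free involution of F*, whose size is odd.
module Submission where

open import Defs hiding (_·_; _∈V_; _≟F_)
import Defs
open import Level using (0ℓ)
open import Data.Nat using (ℕ; zero; suc; _^_; _∸_; _<_; >-nonZero⁻¹)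
import Data.Nat.Properties as ℕ
open import Data.Nat.Divisibility using (_∣_)
open import Data.Fin using (Fin; _<?_; punchIn; punchOut)
import Data.Fin.Properties as Fin
open import Data.Fin.Permutation using (permutation)
open import Data.Bool as Bool using (Bool; true; false; T; _∨_; _xor_)
open import Data.Bool.Properties using (T-≡; ¬-not; ∨-conicalˡ; ∨-conicalʳ; ∨-comm; ∨-assoc; ∨-identityʳ)
open import Data.Product as Product using (_×_; ∃; ∃₂; _,_; proj₁; proj₂)
open import Data.Sum as Sum using (_⊎_; inj₁; inj₂)
open import Data.Empty using (⊥-elim-irr)
open import Data.Irrelevant using ([_])
open import Data.Refinement using (Refinement-syntax; _,_; value; value-injective)
open import Data.Vec using (lookup; tabulate)
open import Data.Vec.Properties
  using (lookup∘tabulate; tabulate∘lookup; tabulate-cong; []=⇒lookup; lookup⇒[]=; ≡-dec)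
open import Function.Base using (_∘_)
open import Function.Bundles using (_↔_; _⤖_; Inverse; Injection; Equivalence; mk↔ₛ′)
open import Function.Properties.Inverse using (↔⇒↣; ↔⇒⤖)
open import Function.Construct.Composition using (_↔-∘_)
open import Relation.Binary.Definitions using (tri<; tri≈; tri>)
open import Relation.Binary.PropositionalEquality
open import Relation.Nullary using (¬_; Dec; yes; no; contradiction)
open import Relation.Nullary.Decidable as Dec using (⌊_⌋; ¬?; _×-dec_)
open import Algebra.Bundles using (CommutativeSemigroup; CommutativeRing)
open import Algebra.Properties.CommutativeMonoid.Sum ℕ.+-0-commutativeMonoid
  using (sum; sum-permute; sum-cong-≗; ∑-distrib-+)

-- Finite sets and parity

module _ where
  open import Data.Nat using (_+_; _*_)

  Even : ℕ → Set
  Even N = ∃ λ k → N ≡ 2 * k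

  indicator : ∀ {P : Set} → Dec P → ℕ
  indicator (yes _) = 1
  indicator (no _)  = 0

  sum-ones : ∀ N → sum {N} (λ _ → 1) ≡ N
  sum-ones zero    = refl
  sum-ones (suc N) = cong suc (sum-ones N)

  [i<j]+[j<i]≡1 : ∀ {N} {i j : Fin N} → i ≢ j → indicator (i <? j) + indicator (j <? i) ≡ 1
  [i<j]+[j<i]≡1 {i = i} {j} i≢j with i <? j | j <? i
  ... | yes i<j | yes j<i = contradiction j<i (Fin.<-asym i<j)
  ... | yes _   | no _    = refl
  ... | no _    | yes _   = refl
  ... | no i≮j  | no j≮i with Fin.<-cmp i j
  ...   | tri< i<j _ _ = contradiction i<j i≮j
  ...   | tri≈ _ i≡j _ = contradiction i≡j i≢j
  ...   | tri> _ _ j<i = contradiction j<i j≮i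

  -- N = #{i | i < σ i} + #{i | σ i < i}, and reindexing along σ shows the two counts agree.
  fixedPointFree-involution⇒even : ∀ {N} (σ : Fin N → Fin N) → (∀ i → σ (σ i) ≡ i) →
                                   (∀ i → σ i ≢ i) → Even N
  fixedPointFree-involution⇒even {N} σ σ∘σ≡id σi≢i = sum ascent , (begin
    N                                ≡⟨ sum-ones N ⟨
    sum {N} (λ _ → 1)                ≡⟨ sum-cong-≗ (λ i → [i<j]+[j<i]≡1 (σi≢i i ∘ sym)) ⟨
    sum (λ i → ascent i + descent i) ≡⟨ ∑-distrib-+ ascent descent ⟩
    sum ascent + sum descent         ≡⟨ cong (sum ascent +_) ascents≡descents ⟨
    sum ascent + sum ascent          ≡⟨ cong (sum ascent +_) (ℕ.+-identityʳ _) ⟨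
    2 * sum ascent                   ∎)
    where
    open ≡-Reasoning
    ascent descent : Fin N → ℕ
    ascent  i = indicator (i <? σ i)
    descent i = indicator (σ i <? i)
    ascents≡descents : sum ascent ≡ sum descent
    ascents≡descents = trans (sum-permute ascent (permutation σ σ σ∘σ≡id σ∘σ≡id))
                             (sum-cong-≗ (λ i → cong (λ j → indicator (σ i <? j)) (σ∘σ≡id i)))

  2^n∸1-odd : ∀ n → 0 < 2 ^ n ∸ 1 → ¬ Even (2 ^ n ∸ 1)
  2^n∸1-odd (suc n) _ (k , 2^[1+n]∸1≡2k) =
    ℕ.even≢odd k (2 ^ n ∸ 1) (trans (sym 2^[1+n]∸1≡2k) 2^[1+n]∸1≡1+2[2^n∸1])
    where
    2^[1+n]∸1≡1+2[2^n∸1] : 2 ^ suc n ∸ 1 ≡ suc (2 * (2 ^ n ∸ 1))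
    2^[1+n]∸1≡1+2[2^n∸1] with 2 ^ n | ℕ.m^n>0 2 n
    ... | suc t | _ = ℕ.+-suc t (t + 0)

  module _ {A : Set} {N : ℕ} (enum : A ↔ Fin N) where
    open Inverse enum using (to; from; strictlyInverseˡ; strictlyInverseʳ)

    finite-fixedPointFree-involution⇒even : (f : A → A) → (∀ x → f (f x) ≡ x) →
                                            (∀ x → f x ≢ x) → Even N
    finite-fixedPointFree-involution⇒even f f∘f≡id fx≢x =
      fixedPointFree-involution⇒even σ σ∘σ≡id σi≢i
      where
      σ : Fin N → Fin N
      σ = to ∘ f ∘ from
      σ∘σ≡id : ∀ i → σ (σ i) ≡ i
      σ∘σ≡id i = trans (cong (to ∘ f) (strictlyInverseʳ _))
                       (trans (cong to (f∘f≡id (from i))) (strictlyInverseˡ i))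
      σi≢i : ∀ i → σ i ≢ i
      σi≢i i σi≡i = fx≢x (from i) (trans (sym (strictlyInverseʳ _)) (cong from σi≡i))

    ∃? : ∀ {P : A → Set} → (∀ x → Dec (P x)) → Dec (∃ P)
    ∃? {P} P? = Dec.map′ (λ (i , p) → from i , p)
                     (λ (x , p) → to x , subst P (sym (strictlyInverseʳ x)) p)
                     (Fin.any? (P? ∘ from))

  module _ {A : Set} {N : ℕ} (enum : A ↔ Fin (suc N)) (a₀ : A) where
    open Inverse enum using (to; from; strictlyInverseˡ; strictlyInverseʳ)

    punctured : [ x ∈ A ∣ x ≢ a₀ ] ↔ Fin N
    punctured = mk↔ₛ′ to′ from′ to′∘from′ from′∘to′
      where
      to′ : [ x ∈ A ∣ x ≢ a₀ ] → Fin N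
      to′ (x , [ x≢a₀ ]) = punchOut {i = to a₀} {j = to x}
        (λ to-a₀≡to-x → ⊥-elim-irr (x≢a₀ (sym (Injection.injective (↔⇒↣ enum) to-a₀≡to-x))))
      from′ : Fin N → [ x ∈ A ∣ x ≢ a₀ ]
      from′ k = from (punchIn (to a₀) k)
              , [ Fin.punchInᵢ≢i (to a₀) k ∘ trans (sym (strictlyInverseˡ _)) ∘ cong to ]
      to′∘from′ : ∀ k → to′ (from′ k) ≡ k
      to′∘from′ k = trans (Fin.punchOut-cong (to a₀) (strictlyInverseˡ _)) (Fin.punchOut-punchIn (to a₀))
      from′∘to′ : ∀ x → from′ (to′ x) ≡ x
      from′∘to′ (x , _) = value-injective (trans (cong from (Fin.punchIn-punchOut _)) (strictlyInverseʳ x))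

data OneOf {ℓ} {A : Set ℓ} (a b c : A) : A → Set ℓ where
  first  : OneOf a b c a
  second : OneOf a b c b
  third  : OneOf a b c c

module _ {c ℓ} (S : CommutativeSemigroup c ℓ) where
  open CommutativeSemigroup S using (_≈_; _∙_) renaming (refl to ≈-refl)
  open import Algebra.Properties.CommutativeSemigroup S
    using (xy∙z≈xz∙y; xy∙z≈yx∙z; xy∙z≈zx∙y; xy∙z≈yz∙x; xy∙z≈zy∙x)

  sum-of-distinct-OneOf : ∀ {a b c x y z} → OneOf a b c x → OneOf a b c y → OneOf a b c z →
                          x ≢ y → y ≢ z → x ≢ z → x ∙ y ∙ z ≈ a ∙ b ∙ c
  sum-of-distinct-OneOf first  second third  _ _ _ = ≈-refl
  sum-of-distinct-OneOf first  third  second _ _ _ = xy∙z≈xz∙y _ _ _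
  sum-of-distinct-OneOf second first  third  _ _ _ = xy∙z≈yx∙z _ _ _
  sum-of-distinct-OneOf second third  first  _ _ _ = xy∙z≈zx∙y _ _ _
  sum-of-distinct-OneOf third  first  second _ _ _ = xy∙z≈yz∙x _ _ _
  sum-of-distinct-OneOf third  second first  _ _ _ = xy∙z≈zy∙x _ _ _
  sum-of-distinct-OneOf first  first  _ x≢y _ _ = contradiction refl x≢y
  sum-of-distinct-OneOf second second _ x≢y _ _ = contradiction refl x≢y
  sum-of-distinct-OneOf third  third  _ x≢y _ _ = contradiction refl x≢y
  sum-of-distinct-OneOf _ first  first  _ y≢z _ = contradiction refl y≢z
  sum-of-distinct-OneOf _ second second _ y≢z _ = contradiction refl y≢z
  sum-of-distinct-OneOf _ third  third  _ y≢z _ = contradiction refl y≢z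
  sum-of-distinct-OneOf first  _ first  _ _ x≢z = contradiction refl x≢z
  sum-of-distinct-OneOf second _ second _ _ x≢z = contradiction refl x≢z
  sum-of-distinct-OneOf third  _ third  _ _ x≢z = contradiction refl x≢z

module GF2^-Properties {n : ℕ} (K : GF2^ n) where
  open GF2^ K
  open Inverse enum using (to; from; strictlyInverseˡ; strictlyInverseʳ)

  infix 4 _∈V_ _≟F_
  infixr 7 _·_

  _∈V_ : F → Sub K → Set
  _∈V_ = Defs._∈V_ K

  _·_ : F → Sub K → Sub K
  _·_ = Defs._·_ K

  _≟F_ : (x y : F) → Dec (x ≡ y)
  _≟F_ = Defs._≟F_ K

  commutativeRing : CommutativeRing 0ℓ 0ℓ
  commutativeRing = record
    { Carrier = F ; _≈_ = _≡_ ; _+_ = _+_ ; _*_ = _*_ ; -_ = -_ ; 0# = 0# ; 1# = 1#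
    ; isCommutativeRing = isCommRing }

  open CommutativeRing commutativeRing
    using ( +-identityˡ; +-identityʳ; -‿inverseʳ; *-comm; *-assoc; *-identityˡ; *-identityʳ
          ; zeroˡ; zeroʳ; distribˡ; distribʳ; ring; +-commutativeSemigroup)
  open import Algebra.Properties.CommutativeSemigroup +-commutativeSemigroup using (interchange; xy∙z≈yz∙x)
  open import Algebra.Properties.Ring ring using (-‿involutive; -0#≈0#)

  1≢0 : 1# ≢ 0#
  1≢0 = 0≢1 ∘ sym

  ⁻¹-inverseˡ : ∀ {x} → x ≢ 0# → x ⁻¹ * x ≡ 1#
  ⁻¹-inverseˡ {x} x≢0 = trans (*-comm (x ⁻¹) x) (inverse x x≢0)

  ⁻¹-cancelˡ : ∀ {x} y → x ≢ 0# → x ⁻¹ * (x * y) ≡ y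
  ⁻¹-cancelˡ {x} y x≢0 = begin
    x ⁻¹ * (x * y) ≡⟨ *-assoc _ x y ⟨
    x ⁻¹ * x * y   ≡⟨ cong (_* y) (⁻¹-inverseˡ x≢0) ⟩
    1# * y         ≡⟨ *-identityˡ y ⟩
    y              ∎
    where open ≡-Reasoning

  *-cancelˡ : ∀ {x y z} → x ≢ 0# → x * y ≡ x * z → y ≡ z
  *-cancelˡ {x} {y} {z} x≢0 xy≡xz =
    trans (sym (⁻¹-cancelˡ y x≢0)) (trans (cong (x ⁻¹ *_) xy≡xz) (⁻¹-cancelˡ z x≢0))

  *-≢0 : ∀ {x y} → x ≢ 0# → y ≢ 0# → x * y ≢ 0#
  *-≢0 {x} x≢0 y≢0 xy≡0 = y≢0 (*-cancelˡ x≢0 (trans xy≡0 (sym (zeroʳ x))))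

  ⁻¹-≢0 : ∀ {x} → x ≢ 0# → x ⁻¹ ≢ 0#
  ⁻¹-≢0 {x} x≢0 x⁻¹≡0 = 1≢0 (trans (sym (inverse x x≢0)) (trans (cong (x *_) x⁻¹≡0) (zeroʳ x)))

  ⁻¹-unique : ∀ {x y} → x ≢ 0# → x * y ≡ 1# → x ⁻¹ ≡ y
  ⁻¹-unique {x} x≢0 xy≡1 = *-cancelˡ x≢0 (trans (inverse x x≢0) (sym xy≡1))

  1⁻¹≡1 : 1# ⁻¹ ≡ 1#
  1⁻¹≡1 = ⁻¹-unique 1≢0 (*-identityˡ 1#)

  ⁻¹-distrib-* : ∀ {x y} → x ≢ 0# → y ≢ 0# → (x * y) ⁻¹ ≡ y ⁻¹ * x ⁻¹
  ⁻¹-distrib-* {x} {y} x≢0 y≢0 = ⁻¹-unique (*-≢0 x≢0 y≢0) (begin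
    x * y * (y ⁻¹ * x ⁻¹)   ≡⟨ *-assoc x y _ ⟩
    x * (y * (y ⁻¹ * x ⁻¹)) ≡⟨ cong (x *_) (*-assoc y (y ⁻¹) _) ⟨
    x * (y * y ⁻¹ * x ⁻¹)   ≡⟨ cong (λ t → x * (t * x ⁻¹)) (inverse y y≢0) ⟩
    x * (1# * x ⁻¹)         ≡⟨ cong (x *_) (*-identityˡ _) ⟩
    x * x ⁻¹                ≡⟨ inverse x x≢0 ⟩
    1#                      ∎)
    where open ≡-Reasoning

  x*y≡y⇒x≡1 : ∀ {x y} → y ≢ 0# → x * y ≡ y → x ≡ 1#
  x*y≡y⇒x≡1 {x} {y} y≢0 xy≡y = *-cancelˡ y≢0 (trans (*-comm y x) (trans xy≡y (sym (*-identityʳ y))))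

  F* : Set
  F* = [ x ∈ F ∣ x ≢ 0# ]

  F*↔Fin : F* ↔ Fin (2 ^ n ∸ 1)
  F*↔Fin = punctured (subst (λ N → F ↔ Fin N) (sym (ℕ.suc-pred (2 ^ n) {{ℕ.m^n≢0 2 n}})) enum) 0#

  1+1≡0 : 1# + 1# ≡ 0#
  1+1≡0 with 1# + 1# ≟F 0#
  ... | yes 1+1≡0 = 1+1≡0
  ... | no 1+1≢0 = contradiction F*-even (2^n∸1-odd n 0<∣F*∣)
    where
    -x≢0 : ∀ {x} → x ≢ 0# → - x ≢ 0#
    -x≢0 {x} x≢0 -x≡0 = x≢0 (trans (sym (-‿involutive x)) (trans (cong -_ -x≡0) -0#≈0#))
    negate : F* → F*
    negate (x , [ x≢0 ]) = - x , [ -x≢0 x≢0 ]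
    -x≢x : ∀ {x} → x ≢ 0# → - x ≢ x
    -x≢x {x} x≢0 -x≡x = *-≢0 1+1≢0 x≢0 (begin
      (1# + 1#) * x   ≡⟨ distribʳ x 1# 1# ⟩
      1# * x + 1# * x ≡⟨ cong₂ _+_ (*-identityˡ x) (trans (*-identityˡ x) (sym -x≡x)) ⟩
      x + - x         ≡⟨ -‿inverseʳ x ⟩
      0#              ∎)
      where open ≡-Reasoning
    F*-even : Even (2 ^ n ∸ 1)
    F*-even = finite-fixedPointFree-involution⇒even F*↔Fin negate
      (λ x → value-injective (-‿involutive (value x)))
      (λ (x , [ x≢0 ]) -x≡x → ⊥-elim-irr (-x≢x x≢0 (cong value -x≡x)))
    0<∣F*∣ : 0 < 2 ^ n ∸ 1
    0<∣F*∣ = >-nonZero⁻¹ _ {{Fin.nonZeroIndex (Inverse.to F*↔Fin (1# , [ 1≢0 ]))}}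

  x+x≡0 : ∀ x → x + x ≡ 0#
  x+x≡0 x = begin
    x + x           ≡⟨ cong₂ _+_ (*-identityˡ x) (*-identityˡ x) ⟨
    1# * x + 1# * x ≡⟨ distribʳ x 1# 1# ⟨
    (1# + 1#) * x   ≡⟨ cong (_* x) 1+1≡0 ⟩
    0# * x          ≡⟨ zeroˡ x ⟩
    0#              ∎
    where open ≡-Reasoning

  -- Subsets of F and the action of F*

  lookup-fromPred : ∀ p x → lookup (fromPred K p) (to x) ≡ p x
  lookup-fromPred p x = trans (lookup∘tabulate (p ∘ from) (to x)) (cong p (strictlyInverseʳ x))

  fromPred-cong : ∀ {p q} → (∀ x → p x ≡ q x) → fromPred K p ≡ fromPred K q
  fromPred-cong p≗q = tabulate-cong (p≗q ∘ from)

  fromPred-lookup : ∀ U → fromPred K (λ x → lookup U (to x)) ≡ U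
  fromPred-lookup U = trans (tabulate-cong (cong (lookup U) ∘ strictlyInverseˡ)) (tabulate∘lookup U)

  ∈-tabulate⁻ : ∀ {f x} → x ∈V tabulate f → T (f (to x))
  ∈-tabulate⁻ {f} {x} x∈ = Equivalence.from T-≡ (trans (sym (lookup∘tabulate f (to x))) ([]=⇒lookup x∈))

  ∈-tabulate⁺ : ∀ {f x} → T (f (to x)) → x ∈V tabulate f
  ∈-tabulate⁺ {f} {x} fx = lookup⇒[]= (to x) _ (trans (lookup∘tabulate f (to x)) (Equivalence.to T-≡ fx))

  T-≟-any⁻ : ∀ y z₁ z₂ z₃ z₄ → T (⌊ y ≟F z₁ ⌋ ∨ ⌊ y ≟F z₂ ⌋ ∨ ⌊ y ≟F z₃ ⌋ ∨ ⌊ y ≟F z₄ ⌋) →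
             y ≡ z₁ ⊎ y ≡ z₂ ⊎ y ≡ z₃ ⊎ y ≡ z₄
  T-≟-any⁻ y z₁ z₂ z₃ z₄ t with y ≟F z₁ | y ≟F z₂ | y ≟F z₃ | y ≟F z₄
  ... | yes y≡z₁ | _        | _        | _        = inj₁ y≡z₁
  ... | no _     | yes y≡z₂ | _        | _        = inj₂ (inj₁ y≡z₂)
  ... | no _     | no _     | yes y≡z₃ | _        = inj₂ (inj₂ (inj₁ y≡z₃))
  ... | no _     | no _     | no _     | yes y≡z₄ = inj₂ (inj₂ (inj₂ y≡z₄))

  T-≟-any⁺ : ∀ y z₁ z₂ z₃ z₄ → y ≡ z₁ ⊎ y ≡ z₂ ⊎ y ≡ z₃ ⊎ y ≡ z₄ →
             T (⌊ y ≟F z₁ ⌋ ∨ ⌊ y ≟F z₂ ⌋ ∨ ⌊ y ≟F z₃ ⌋ ∨ ⌊ y ≟F z₄ ⌋)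
  T-≟-any⁺ y z₁ z₂ z₃ z₄ y∈ with y ≟F z₁ | y ≟F z₂ | y ≟F z₃ | y ≟F z₄
  ... | yes _  | _      | _      | _      = _
  ... | no _   | yes _  | _      | _      = _
  ... | no _   | no _   | yes _  | _      = _
  ... | no _   | no _   | no _   | yes _  = _
  ... | no y≢₁ | no y≢₂ | no y≢₃ | no y≢₄ = Sum.[ y≢₁ , Sum.[ y≢₂ , Sum.[ y≢₃ , y≢₄ ] ] ] y∈

  -- fromPred K p tests p at from (to x), which equals x only propositionally.
  ∈-span2⁻ : ∀ {a b x} → x ∈V span2 K a b → ∃₂ λ e₁ e₂ → x ≡ sel K e₁ a + sel K e₂ b
  ∈-span2⁻ {a} {b} {x} x∈ with T-≟-any⁻ (from (to x)) _ _ _ _ (∈-tabulate⁻ x∈)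
  ... | inj₁ x≡0+0                = false , false , trans (sym (strictlyInverseʳ x)) x≡0+0
  ... | inj₂ (inj₁ x≡a+0)         = true  , false , trans (sym (strictlyInverseʳ x)) x≡a+0
  ... | inj₂ (inj₂ (inj₁ x≡0+b))  = false , true  , trans (sym (strictlyInverseʳ x)) x≡0+b
  ... | inj₂ (inj₂ (inj₂ x≡a+b))  = true  , true  , trans (sym (strictlyInverseʳ x)) x≡a+b

  ∈-span2ˡ : ∀ {a b} → a ∈V span2 K a b
  ∈-span2ˡ {a} = ∈-tabulate⁺ (T-≟-any⁺ (from (to a)) _ _ _ _
    (inj₂ (inj₁ (trans (strictlyInverseʳ a) (sym (+-identityʳ a))))))

  ∈-span2ʳ : ∀ {a b} → b ∈V span2 K a b
  ∈-span2ʳ {b = b} = ∈-tabulate⁺ (T-≟-any⁺ (from (to b)) _ _ _ _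
    (inj₂ (inj₂ (inj₁ (trans (strictlyInverseʳ b) (sym (+-identityˡ b)))))))

  ·-∈ : ∀ {γ U y} → γ ≢ 0# → y ∈V U → γ * y ∈V γ · U
  ·-∈ {γ} {U} {y} γ≢0 y∈U = lookup⇒[]= (to (γ * y)) _ (begin
    lookup (γ · U) (to (γ * y))       ≡⟨ lookup-fromPred (λ x → lookup U (to (γ ⁻¹ * x))) (γ * y) ⟩
    lookup U (to (γ ⁻¹ * (γ * y)))    ≡⟨ cong (lookup U ∘ to) (⁻¹-cancelˡ y γ≢0) ⟩
    lookup U (to y)                   ≡⟨ []=⇒lookup y∈U ⟩
    true                              ∎)
    where open ≡-Reasoning

  ·-identity : ∀ U → 1# · U ≡ U
  ·-identity U = trans (fromPred-cong (cong (lookup U ∘ to) ∘ 1⁻¹*x≡x)) (fromPred-lookup U)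
    where
    1⁻¹*x≡x : ∀ x → 1# ⁻¹ * x ≡ x
    1⁻¹*x≡x x = trans (cong (_* x) 1⁻¹≡1) (*-identityˡ x)

  ·-assoc : ∀ {α β} U → α ≢ 0# → β ≢ 0# → α · β · U ≡ (α * β) · U
  ·-assoc {α} {β} U α≢0 β≢0 = fromPred-cong λ x → begin
    lookup (β · U) (to (α ⁻¹ * x))  ≡⟨ lookup-fromPred (λ x → lookup U (to (β ⁻¹ * x))) (α ⁻¹ * x) ⟩
    lookup U (to (β ⁻¹ * (α ⁻¹ * x))) ≡⟨ cong (lookup U ∘ to) (*-assoc _ _ x) ⟨
    lookup U (to (β ⁻¹ * α ⁻¹ * x))   ≡⟨ cong (λ t → lookup U (to (t * x))) (⁻¹-distrib-* α≢0 β≢0) ⟨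
    lookup U (to ((α * β) ⁻¹ * x))    ∎
    where open ≡-Reasoning

  ⁻¹·-cancel : ∀ {γ} U → γ ≢ 0# → γ ⁻¹ · γ · U ≡ U
  ⁻¹·-cancel {γ} U γ≢0 =
    trans (·-assoc U (⁻¹-≢0 γ≢0) γ≢0) (trans (cong (_· U) (⁻¹-inverseˡ γ≢0)) (·-identity U))

  ·-injective : ∀ {γ U W} → γ ≢ 0# → γ · U ≡ γ · W → U ≡ W
  ·-injective {γ} {U} {W} γ≢0 γU≡γW =
    trans (sym (⁻¹·-cancel U γ≢0)) (trans (cong (γ ⁻¹ ·_) γU≡γW) (⁻¹·-cancel W γ≢0))

  -- Coordinates with respect to an independent triple, and triangles

  lincomb : F → F → F → Bool → Bool → Bool → F
  lincomb a b c e₁ e₂ e₃ = sel K e₁ a + sel K e₂ b + sel K e₃ c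

  sel-xor : ∀ d e x → sel K d x + sel K e x ≡ sel K (d xor e) x
  sel-xor false e     x = +-identityˡ (sel K e x)
  sel-xor true  false x = +-identityʳ x
  sel-xor true  true  x = x+x≡0 x

  lincomb-xor : ∀ {a b c} d₁ d₂ d₃ e₁ e₂ e₃ →
                lincomb a b c d₁ d₂ d₃ + lincomb a b c e₁ e₂ e₃ ≡
                lincomb a b c (d₁ xor e₁) (d₂ xor e₂) (d₃ xor e₃)
  lincomb-xor {a} {b} {c} d₁ d₂ d₃ e₁ e₂ e₃ = begin
    (sel K d₁ a + sel K d₂ b + sel K d₃ c) + (sel K e₁ a + sel K e₂ b + sel K e₃ c)
      ≡⟨ interchange _ _ _ _ ⟩
    (sel K d₁ a + sel K d₂ b + (sel K e₁ a + sel K e₂ b)) + (sel K d₃ c + sel K e₃ c)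
      ≡⟨ cong (_+ (sel K d₃ c + sel K e₃ c)) (interchange _ _ _ _) ⟩
    (sel K d₁ a + sel K e₁ a) + (sel K d₂ b + sel K e₂ b) + (sel K d₃ c + sel K e₃ c)
      ≡⟨ cong₂ _+_ (cong₂ _+_ (sel-xor d₁ e₁ a) (sel-xor d₂ e₂ b)) (sel-xor d₃ e₃ c) ⟩
    lincomb a b c (d₁ xor e₁) (d₂ xor e₂) (d₃ xor e₃) ∎
    where open ≡-Reasoning

  Indep3⇒lincomb≡0⇒trivial : ∀ {a b c e₁ e₂ e₃} → Indep3 K a b c → lincomb a b c e₁ e₂ e₃ ≡ 0# →
                              e₁ ≡ false × e₂ ≡ false × e₃ ≡ false
  Indep3⇒lincomb≡0⇒trivial {e₁ = e₁} {e₂} {e₃} I comb≡0 =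
    ∨-conicalˡ e₁ _ e≡0 , ∨-conicalˡ e₂ e₃ (∨-conicalʳ e₁ _ e≡0) , ∨-conicalʳ e₂ e₃ (∨-conicalʳ e₁ _ e≡0)
    where
    e≡0 : e₁ ∨ e₂ ∨ e₃ ≡ false
    e≡0 = ¬-not (λ e≡1 → I e₁ e₂ e₃ e≡1 comb≡0)

  xor≡false⇒≡ : ∀ {x y} → x xor y ≡ false → x ≡ y
  xor≡false⇒≡ {false} {false} _ = refl
  xor≡false⇒≡ {true}  {true}  _ = refl

  lincomb-injective : ∀ {a b c} → Indep3 K a b c → ∀ d₁ d₂ d₃ e₁ e₂ e₃ →
                      lincomb a b c d₁ d₂ d₃ ≡ lincomb a b c e₁ e₂ e₃ →
                      d₁ ≡ e₁ × d₂ ≡ e₂ × d₃ ≡ e₃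
  lincomb-injective {a} {b} {c} I d₁ d₂ d₃ e₁ e₂ e₃ d≡e =
    Product.map xor≡false⇒≡ (Product.map xor≡false⇒≡ xor≡false⇒≡) (Indep3⇒lincomb≡0⇒trivial I d+e≡0)
    where
    open ≡-Reasoning
    d+e≡0 : lincomb a b c (d₁ xor e₁) (d₂ xor e₂) (d₃ xor e₃) ≡ 0#
    d+e≡0 = begin
      lincomb a b c (d₁ xor e₁) (d₂ xor e₂) (d₃ xor e₃) ≡⟨ lincomb-xor d₁ d₂ d₃ e₁ e₂ e₃ ⟨
      lincomb a b c d₁ d₂ d₃ + lincomb a b c e₁ e₂ e₃   ≡⟨ cong (_+ lincomb a b c e₁ e₂ e₃) d≡e ⟩
      lincomb a b c e₁ e₂ e₃ + lincomb a b c e₁ e₂ e₃   ≡⟨ x+x≡0 _ ⟩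
      0#                                                ∎

  Indep3-rotate : ∀ {a b c} → Indep3 K a b c → Indep3 K b c a
  Indep3-rotate {a} {b} {c} I e₁ e₂ e₃ e≢0 comb≡0 =
    I e₃ e₁ e₂ (trans (∨-comm e₃ (e₁ ∨ e₂)) (trans (∨-assoc e₁ e₂ e₃) e≢0))
      (trans (xy∙z≈yz∙x (sel K e₃ a) (sel K e₁ b) (sel K e₂ c)) comb≡0)

  Indep3⇒Indep2 : ∀ {a b c} → Indep3 K a b c → Indep2 K a b
  Indep3⇒Indep2 I e₁ e₂ e≢0 comb≡0 =
    I e₁ e₂ false (trans (cong (e₁ ∨_) (∨-identityʳ e₂)) e≢0) (trans (+-identityʳ _) comb≡0)

  module _ {a b c : F} (I : Indep3 K a b c) where

    lincomb-a : lincomb a b c true false false ≡ a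
    lincomb-a = trans (+-identityʳ _) (+-identityʳ a)

    lincomb-b : lincomb a b c false true false ≡ b
    lincomb-b = trans (+-identityʳ _) (+-identityˡ b)

    ⟨a,b⟩-lincomb : ∀ e₁ e₂ → sel K e₁ a + sel K e₂ b ≡ lincomb a b c e₁ e₂ false
    ⟨a,b⟩-lincomb e₁ e₂ = sym (+-identityʳ _)

    ⟨b,c⟩-lincomb : ∀ e₁ e₂ → sel K e₁ b + sel K e₂ c ≡ lincomb a b c false e₁ e₂
    ⟨b,c⟩-lincomb e₁ e₂ = cong (_+ sel K e₂ c) (sym (+-identityˡ _))

    Indep3⇒a≢0 : a ≢ 0#
    Indep3⇒a≢0 a≡0 = I true false false refl (trans lincomb-a a≡0)

    Indep3⇒a≢b : a ≢ b
    Indep3⇒a≢b a≡b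
      with lincomb-injective I true false false false true false (trans lincomb-a (trans a≡b (sym lincomb-b)))
    ... | () , _

    Indep3⇒a+b+c≢0 : a + b + c ≢ 0#
    Indep3⇒a+b+c≢0 = I true true true refl

    Indep3⇒⟨a,b⟩≢⟨b,c⟩ : span2 K a b ≢ span2 K b c
    Indep3⇒⟨a,b⟩≢⟨b,c⟩ ⟨a,b⟩≡⟨b,c⟩ with ∈-span2⁻ (subst (a ∈V_) ⟨a,b⟩≡⟨b,c⟩ ∈-span2ˡ)
    ... | e₁ , e₂ , a≡
      with lincomb-injective I true false false false e₁ e₂ (trans lincomb-a (trans a≡ (⟨b,c⟩-lincomb e₁ e₂)))
    ...   | () , _

    Indep3⇒⟨a,b⟩∩⟨b,c⟩≡b : ∀ {v} → v ∈V span2 K a b → v ∈V span2 K b c → v ≢ 0# → v ≡ b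
    Indep3⇒⟨a,b⟩∩⟨b,c⟩≡b v∈⟨a,b⟩ v∈⟨b,c⟩ v≢0 with ∈-span2⁻ v∈⟨a,b⟩ | ∈-span2⁻ v∈⟨b,c⟩
    ... | e₁ , e₂ , refl | e₃ , e₄ , v≡
      with lincomb-injective I e₁ e₂ false false e₃ e₄
             (trans (sym (⟨a,b⟩-lincomb e₁ e₂)) (trans v≡ (⟨b,c⟩-lincomb e₃ e₄)))
    ...   | refl , refl , refl = trans (+-identityˡ _) (sel≢0⇒≡ e₂ (v≢0 ∘ trans (+-identityˡ _)))
      where
      sel≢0⇒≡ : ∀ e {x} → sel K e x ≢ 0# → sel K e x ≡ x
      sel≢0⇒≡ true  _   = refl
      sel≢0⇒≡ false 0≢0 = contradiction refl 0≢0

  X∈XYZ : ∀ {X Y Z} → InTri K X X Y Z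
  X∈XYZ = inj₁ refl

  Y∈XYZ : ∀ {X Y Z} → InTri K Y X Y Z
  Y∈XYZ = inj₂ (inj₁ refl)

  Z∈XYZ : ∀ {X Y Z} → InTri K Z X Y Z
  Z∈XYZ = inj₂ (inj₂ refl)

  Side : F → F → F → Sub K → Set
  Side a b c W = InTri K W (span2 K a b) (span2 K b c) (span2 K c a)

  Indep3⇒sides-meet-in-vertices : ∀ {a b c W W′ v} → Indep3 K a b c → Side a b c W → Side a b c W′ →
                                  W ≢ W′ → v ∈V W → v ∈V W′ → v ≢ 0# → OneOf a b c v
  Indep3⇒sides-meet-in-vertices I (inj₁ refl) (inj₁ refl) W≢W′ _ _ _ = contradiction refl W≢W′
  Indep3⇒sides-meet-in-vertices I (inj₂ (inj₁ refl)) (inj₂ (inj₁ refl)) W≢W′ _ _ _ = contradiction refl W≢W′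
  Indep3⇒sides-meet-in-vertices I (inj₂ (inj₂ refl)) (inj₂ (inj₂ refl)) W≢W′ _ _ _ = contradiction refl W≢W′
  Indep3⇒sides-meet-in-vertices I (inj₁ refl) (inj₂ (inj₁ refl)) _ v∈W v∈W′ v≢0
    rewrite Indep3⇒⟨a,b⟩∩⟨b,c⟩≡b I v∈W v∈W′ v≢0 = second
  Indep3⇒sides-meet-in-vertices I (inj₂ (inj₁ refl)) (inj₁ refl) _ v∈W v∈W′ v≢0
    rewrite Indep3⇒⟨a,b⟩∩⟨b,c⟩≡b I v∈W′ v∈W v≢0 = second
  Indep3⇒sides-meet-in-vertices I (inj₂ (inj₁ refl)) (inj₂ (inj₂ refl)) _ v∈W v∈W′ v≢0
    rewrite Indep3⇒⟨a,b⟩∩⟨b,c⟩≡b (Indep3-rotate I) v∈W v∈W′ v≢0 = third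
  Indep3⇒sides-meet-in-vertices I (inj₂ (inj₂ refl)) (inj₂ (inj₁ refl)) _ v∈W v∈W′ v≢0
    rewrite Indep3⇒⟨a,b⟩∩⟨b,c⟩≡b (Indep3-rotate I) v∈W′ v∈W v≢0 = third
  Indep3⇒sides-meet-in-vertices I (inj₂ (inj₂ refl)) (inj₁ refl) _ v∈W v∈W′ v≢0
    rewrite Indep3⇒⟨a,b⟩∩⟨b,c⟩≡b (Indep3-rotate (Indep3-rotate I)) v∈W v∈W′ v≢0 = first
  Indep3⇒sides-meet-in-vertices I (inj₁ refl) (inj₂ (inj₂ refl)) _ v∈W v∈W′ v≢0
    rewrite Indep3⇒⟨a,b⟩∩⟨b,c⟩≡b (Indep3-rotate (Indep3-rotate I)) v∈W′ v∈W v≢0 = first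

  Indep3⇒stabiliser-trivial : ∀ {a b c γ} → Indep3 K a b c → γ ≢ 0# →
                              (∀ {W} → Side a b c W → Side a b c (γ · W)) → γ ≡ 1#
  Indep3⇒stabiliser-trivial {a} {b} {c} {γ} I γ≢0 γ-preserves = x*y≡y⇒x≡1 (Indep3⇒a+b+c≢0 I) (begin
    γ * (a + b + c)       ≡⟨ distribˡ γ (a + b) c ⟩
    γ * (a + b) + γ * c   ≡⟨ cong (_+ γ * c) (distribˡ γ a b) ⟩
    γ * a + γ * b + γ * c ≡⟨ sum-of-distinct-OneOf +-commutativeSemigroup γa∈ γb∈ γc∈
                               (Indep3⇒a≢b I ∘ *-cancelˡ γ≢0) (Indep3⇒a≢b Ibca ∘ *-cancelˡ γ≢0)
                               (Indep3⇒a≢b Icab ∘ sym ∘ *-cancelˡ γ≢0) ⟩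
    a + b + c             ∎)
    where
    open ≡-Reasoning
    Ibca : Indep3 K b c a
    Ibca = Indep3-rotate I
    Icab : Indep3 K c a b
    Icab = Indep3-rotate Ibca
    γ-vertex : ∀ {W W′ v} → Side a b c W → Side a b c W′ → W ≢ W′ → v ∈V W → v ∈V W′ → v ≢ 0# →
               OneOf a b c (γ * v)
    γ-vertex W∈ W′∈ W≢W′ v∈W v∈W′ v≢0 =
      Indep3⇒sides-meet-in-vertices I (γ-preserves W∈) (γ-preserves W′∈) (W≢W′ ∘ ·-injective γ≢0)
        (·-∈ γ≢0 v∈W) (·-∈ γ≢0 v∈W′) (*-≢0 γ≢0 v≢0)
    γa∈ : OneOf a b c (γ * a)
    γa∈ = γ-vertex X∈XYZ Z∈XYZ (Indep3⇒⟨a,b⟩≢⟨b,c⟩ Icab ∘ sym) ∈-span2ˡ ∈-span2ʳ (Indep3⇒a≢0 I)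
    γb∈ : OneOf a b c (γ * b)
    γb∈ = γ-vertex X∈XYZ Y∈XYZ (Indep3⇒⟨a,b⟩≢⟨b,c⟩ I) ∈-span2ʳ ∈-span2ˡ (Indep3⇒a≢0 Ibca)
    γc∈ : OneOf a b c (γ * c)
    γc∈ = γ-vertex Y∈XYZ Z∈XYZ (Indep3⇒⟨a,b⟩≢⟨b,c⟩ Ibca) ∈-span2ʳ ∈-span2ˡ (Indep3⇒a≢0 Icab)

  InOrbit? : ∀ U W → Dec (InOrbit K U W)
  InOrbit? U W = ∃? enum (λ γ → ¬? (γ ≟F 0#) ×-dec ≡-dec Bool._≟_ W (γ · U))

  Orbit-≡ : ∀ {U} {o o′ : Orbit K U} → Orbit.elt o ≡ Orbit.elt o′ → o ≡ o′
  Orbit-≡ {o = orb _ _} {orb _ _} refl = refl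

  ·-cancelʳ : ∀ {U γ γ′} → (∀ {δ} → δ ≢ 0# → δ · U ≡ U → δ ≡ 1#) →
              γ ≢ 0# → γ′ ≢ 0# → γ · U ≡ γ′ · U → γ ≡ γ′
  ·-cancelʳ {U} {γ} {γ′} free γ≢0 γ′≢0 γU≡γ′U =
    *-cancelˡ (⁻¹-≢0 γ′≢0) (trans (free (*-≢0 (⁻¹-≢0 γ′≢0) γ≢0) γ′⁻¹γU≡U) (sym (⁻¹-inverseˡ γ′≢0)))
    where
    γ′⁻¹γU≡U : (γ′ ⁻¹ * γ) · U ≡ U
    γ′⁻¹γU≡U = trans (sym (·-assoc U (⁻¹-≢0 γ′≢0) γ≢0))
                     (trans (cong (γ′ ⁻¹ ·_) γU≡γ′U) (⁻¹·-cancel U γ′≢0))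

  -- The witness γ is an irrelevant field of Orbit, so it is recomputed by exhaustive search.
  free-orbit↔F* : ∀ {U} → (∀ {γ} → γ ≢ 0# → γ · U ≡ U → γ ≡ 1#) → Orbit K U ↔ F*
  free-orbit↔F* {U} free = mk↔ₛ′ to′ from′ to′∘from′ from′∘to′
    where
    witness : ∀ {W} → .(InOrbit K U W) → InOrbit K U W
    witness {W} = Dec.recompute (InOrbit? U W)
    to′ : Orbit K U → F*
    to′ (orb W W∈) = proj₁ (witness W∈) , [ proj₁ (proj₂ (witness W∈)) ]
    from′ : F* → Orbit K U
    from′ (γ , [ γ≢0 ]) = orb (γ · U) (γ , γ≢0 , refl)
    to′∘from′ : ∀ γ → to′ (from′ γ) ≡ γ
    to′∘from′ (γ , [ γ≢0 ]) with witness {γ · U} (γ , γ≢0 , refl)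
    ... | γ′ , γ′≢0 , γU≡γ′U = value-injective
      (·-cancelʳ free γ′≢0 (Dec.recompute (¬? (γ ≟F 0#)) γ≢0) (sym γU≡γ′U))
    from′∘to′ : ∀ o → from′ (to′ o) ≡ o
    from′∘to′ (orb W W∈) = Orbit-≡ (sym (proj₂ (proj₂ (witness W∈))))

module _ {n : ℕ} {K : GF2^ n} where
  open GF2^ K
  open GF2^-Properties K

  SameTri-sym : ∀ {X Y Z X′ Y′ Z′} → SameTri K X Y Z X′ Y′ Z′ → SameTri K X′ Y′ Z′ X Y Z
  SameTri-sym same W = proj₂ (same W) , proj₁ (same W)

  SameTri-trans : ∀ {X Y Z X′ Y′ Z′ X″ Y″ Z″} → SameTri K X Y Z X′ Y′ Z′ → SameTri K X′ Y′ Z′ X″ Y″ Z″ →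
                  SameTri K X Y Z X″ Y″ Z″
  SameTri-trans same same′ W = proj₁ (same′ W) ∘ proj₁ (same W) , proj₂ (same W) ∘ proj₂ (same′ W)

  InTri-· : ∀ {γ U X Y Z} → InTri K U X Y Z → InTri K (γ · U) (γ · X) (γ · Y) (γ · Z)
  InTri-· {γ} = Sum.map (cong (γ ·_)) (Sum.map (cong (γ ·_)) (cong (γ ·_)))

  IsTriangle⇒IsSub2 : ∀ {U X Y Z} → IsTriangle K X Y Z → InTri K U X Y Z → IsSub2 K U
  IsTriangle⇒IsSub2 (a , b , c , I , X≡ , _ , _) (inj₁ U≡X) =
    a , b , Indep3⇒Indep2 I , trans U≡X X≡
  IsTriangle⇒IsSub2 (a , b , c , I , _ , Y≡ , _) (inj₂ (inj₁ U≡Y)) =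
    b , c , Indep3⇒Indep2 (Indep3-rotate I) , trans U≡Y Y≡
  IsTriangle⇒IsSub2 (a , b , c , I , _ , _ , Z≡) (inj₂ (inj₂ U≡Z)) =
    c , a , Indep3⇒Indep2 (Indep3-rotate (Indep3-rotate I)) , trans U≡Z Z≡

  IsTriangle⇒sides-distinct : ∀ {X Y Z} → IsTriangle K X Y Z → X ≢ Y × Y ≢ Z × X ≢ Z
  IsTriangle⇒sides-distinct (a , b , c , I , refl , refl , refl) =
      Indep3⇒⟨a,b⟩≢⟨b,c⟩ I
    , Indep3⇒⟨a,b⟩≢⟨b,c⟩ (Indep3-rotate I)
    , Indep3⇒⟨a,b⟩≢⟨b,c⟩ (Indep3-rotate (Indep3-rotate I)) ∘ sym

  module _ {m : ℕ} {𝓑 : BlockSet K} (D : IsDesarguesianGDTD K m 𝓑) (G : GInvariant K 𝓑) where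
    open IsDesarguesianGDTD D

    blocks-sharing-a-side-coincide : ∀ {U X Y Z X′ Y′ Z′} → 𝓑 X Y Z → 𝓑 X′ Y′ Z′ →
                                     InTri K U X Y Z → InTri K U X′ Y′ Z′ → SameTri K X Y Z X′ Y′ Z′
    blocks-sharing-a-side-coincide {U} B B′ U∈B U∈B′
      with partition U (IsTriangle⇒IsSub2 (triangles _ _ _ B) U∈B)
    ... | inj₁ ((_ , _ , _ , _ , _ , unique) , _) =
      SameTri-trans (SameTri-sym (unique _ _ _ B U∈B)) (unique _ _ _ B′ U∈B′)
    ... | inj₂ (in-no-block , _) = contradiction U∈B (in-no-block _ _ _ B)

    block-stabiliser-trivial : ∀ {γ U X Y Z} → 𝓑 X Y Z → γ ≢ 0# →
                               InTri K U X Y Z → InTri K (γ · U) X Y Z → γ ≡ 1#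
    block-stabiliser-trivial {γ} {U} {X} {Y} {Z} B γ≢0 U∈B γU∈B with triangles X Y Z B
    ... | a , b , c , I , refl , refl , refl =
      Indep3⇒stabiliser-trivial I γ≢0 (λ {W} W∈B → proj₂ (B≈γB (γ · W)) (InTri-· W∈B))
      where
      B≈γB : SameTri K X Y Z (γ · X) (γ · Y) (γ · Z)
      B≈γB = blocks-sharing-a-side-coincide B (G γ X Y Z γ≢0 B) γU∈B (InTri-· U∈B)

    side-stabiliser-trivial : ∀ {U X Y Z} → 𝓑 X Y Z → InTri K U X Y Z → ∀ {γ} → γ ≢ 0# → γ · U ≡ U → γ ≡ 1#
    side-stabiliser-trivial {X = X} {Y} {Z} B U∈B γ≢0 γU≡U =
      block-stabiliser-trivial B γ≢0 U∈B (subst (λ W → InTri K W X Y Z) (sym γU≡U) U∈B)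

    block-sides-in-distinct-orbits : ∀ {U U′ X Y Z} → 𝓑 X Y Z → InTri K U X Y Z → InTri K U′ X Y Z →
                                     U ≢ U′ → ¬ SameOrbit K U U′
    block-sides-in-distinct-orbits {U} {U′} {X} {Y} {Z} B U∈B U′∈B U≢U′ same
      with proj₂ (same U′) (1# , 1≢0 , sym (·-identity U′))
    ... | γ , γ≢0 , U′≡γU = U≢U′ (begin
      U      ≡⟨ ·-identity U ⟨
      1# · U ≡⟨ cong (_· U) γ≡1 ⟨
      γ · U  ≡⟨ U′≡γU ⟨
      U′     ∎)
      where
      open ≡-Reasoning
      γ≡1 : γ ≡ 1#
      γ≡1 = block-stabiliser-trivial B γ≢0 U∈B (subst (λ W → InTri K W X Y Z) U′≡γU U′∈B)

    block-orbits-distinct : ∀ {X Y Z} → 𝓑 X Y Z → ¬ SameOrbit K X Y × ¬ SameOrbit K Y Z × ¬ SameOrbit K X Z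
    block-orbits-distinct {X} {Y} {Z} B with IsTriangle⇒sides-distinct (triangles X Y Z B)
    ... | X≢Y , Y≢Z , X≢Z =
        block-sides-in-distinct-orbits B X∈XYZ Y∈XYZ X≢Y
      , block-sides-in-distinct-orbits B Y∈XYZ Z∈XYZ Y≢Z
      , block-sides-in-distinct-orbits B X∈XYZ Z∈XYZ X≢Z

    block-orbits⤖Fin : ∀ {X Y Z} → 𝓑 X Y Z →
      (Orbit K X ⤖ Fin (2 ^ n ∸ 1)) × (Orbit K Y ⤖ Fin (2 ^ n ∸ 1)) × (Orbit K Z ⤖ Fin (2 ^ n ∸ 1))
    block-orbits⤖Fin {X} {Y} {Z} B = orbit⤖Fin X∈XYZ , orbit⤖Fin Y∈XYZ , orbit⤖Fin Z∈XYZ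
      where
      orbit⤖Fin : ∀ {U} → InTri K U X Y Z → Orbit K U ⤖ Fin (2 ^ n ∸ 1)
      orbit⤖Fin U∈B = ↔⇒⤖ (F*↔Fin ↔-∘ free-orbit↔F* (side-stabiliser-trivial B U∈B))

lemma2 : ∀ {n m : ℕ} (K : GF2^ n) → m ∣ n → (𝓑 : BlockSet K) →
    IsDesarguesianGDTD K m 𝓑 → GInvariant K 𝓑 →
    ∀ B₁ B₂ B₃ → 𝓑 B₁ B₂ B₃ →
    (¬ SameOrbit K B₁ B₂ × ¬ SameOrbit K B₂ B₃ × ¬ SameOrbit K B₁ B₃) ×
    (Orbit K B₁ ⤖ Fin (2 ^ n ∸ 1)) × (Orbit K B₂ ⤖ Fin (2 ^ n ∸ 1)) × (Orbit K B₃ ⤖ Fin (2 ^ n ∸ 1))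
lemma2 K _ 𝓑 D G B₁ B₂ B₃ B = block-orbits-distinct D G B , block-orbits⤖Fin D G B
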